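{- Let $G$ be a nearly regular $2$-balanced $5$-partite tournament. If $G$ has no strong partition, then $G$ has at least $12$ good partitions.
   Context: A $2$-balanced $5$-partite tournament is an orientation of the complete $5$-partite graph with all parts of size $2$; it is nearly regular if $|d^+(v)-d^-(v)|\le 2$ for every vertex $v$. A partition into maximal tournaments is a pair of vertex-disjoint tournaments of order $5$ covering all vertices (each containing one vertex from each partite set). It is a strong partition if both tournaments are strongly connected. A partition is good if one of its two tournaments is strongly connected and the other is not strongly connected and contains exactly one vertex $v$ with $\min\{d^+_T(v),d^-_T(v)\}=0$ in that tournament $T$. -}

module Defs where

open import Data.Nat using (ℕ; _+_; _≤_)
open import Data.Bool using (Bool; true; false; not; _∧_)
open import Data.Fin using (Fin; zero; suc; _≟_)
open import Data.Fin.Properties using ()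
open import Data.Product using (Σ; ∃; _×_; _,_; proj₁; proj₂)
open import Data.Sum using (_⊎_)
open import Data.List using (List; length; filterᵇ; allFin; cartesianProduct)
open import Data.Vec using (Vec; lookup; head)
open import Relation.Nullary using (¬_; does)
open import Relation.Binary.PropositionalEquality using (_≡_)
open import Function.Definitions using (Injective)

-- The complete 5-partite graph with all parts of size 2.
-- A vertex is (i , j): the j-th vertex of the i-th partite set.

Vertex : Set
Vertex = Fin 5 × Fin 2

part : Vertex → Fin 5
part = proj₁

allVertices : List Vertex
allVertices = cartesianProduct (allFin 5) (allFin 2)

differentParts : Vertex → Vertex → Bool
differentParts u v = not (does (part u ≟ part v))

-- A 2-balanced 5-partite tournament: an orientation of K_{2,2,2,2,2}.
-- 'arcᵒ u v' is read as "u → v"; only its values on pairs in different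
-- partite sets matter, and there exactly one direction is chosen.
record MultipartiteTournament : Set where
  field
    arcᵒ     : Vertex → Vertex → Bool
    oriented : ∀ u v → ¬ (part u ≡ part v) → arcᵒ u v ≡ not (arcᵒ v u)

  arc : Vertex → Vertex → Bool
  arc u v = differentParts u v ∧ arcᵒ u v

  outdeg : Vertex → ℕ
  outdeg v = length (filterᵇ (λ w → arc v w) allVertices)

  indeg : Vertex → ℕ
  indeg v = length (filterᵇ (λ w → arc w v) allVertices)

open MultipartiteTournament public

NearlyRegular : MultipartiteTournament → Set
NearlyRegular G = ∀ v → (outdeg G v ≤ indeg G v + 2) × (indeg G v ≤ outdeg G v + 2)

-- Tournaments on Fin n, given by an arc relation (used for i ≠ j only).

Digraph : ℕ → Set
Digraph n = Fin n → Fin n → Bool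

data Reach {n : ℕ} (A : Digraph n) : Fin n → Fin n → Set where
  here  : ∀ {i} → Reach A i i
  there : ∀ {i j k} → A i j ≡ true → Reach A j k → Reach A i k

StronglyConnected : ∀ {n} → Digraph n → Set
StronglyConnected {n} A = ∀ (i j : Fin n) → Reach A i j

tOutdeg : ∀ {n} → Digraph n → Fin n → ℕ
tOutdeg {n} A i = length (filterᵇ (λ j → not (does (i ≟ j)) ∧ A i j) (allFin n))

tIndeg : ∀ {n} → Digraph n → Fin n → ℕ
tIndeg {n} A i = length (filterᵇ (λ j → not (does (i ≟ j)) ∧ A j i) (allFin n))

IsSourceOrSink : ∀ {n} → Digraph n → Fin n → Set
IsSourceOrSink A v = (tOutdeg A v ≡ 0) ⊎ (tIndeg A v ≡ 0)

ExactlyOneSourceOrSink : ∀ {n} → Digraph n → Set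
ExactlyOneSourceOrSink {n} A =
  Σ (Fin n) λ v → IsSourceOrSink A v × (∀ w → IsSourceOrSink A w → w ≡ v)

-- A choice vector s picks from partite set i the vertex (i , s[i]) for the
-- first tournament; the second tournament gets the other vertex of each
-- part.  The ordered pair (T₁,T₂) from s and from its complement describe
-- the same (unordered) partition, so partitions are in bijection with
-- choice vectors whose head is zero.

Choice : Set
Choice = Vec (Fin 2) 5

flip2 : Fin 2 → Fin 2
flip2 zero = suc zero
flip2 (suc zero) = zero

IsPartition : Choice → Set
IsPartition s = head s ≡ zero

induced : MultipartiteTournament → (Fin 5 → Fin 2) → Digraph 5
induced G c i j = arc G (i , c i) (j , c j)

T₁ T₂ : MultipartiteTournament → Choice → Digraph 5
T₁ G s = induced G (λ i → lookup s i)
T₂ G s = induced G (λ i → flip2 (lookup s i))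

StrongPartition : MultipartiteTournament → Choice → Set
StrongPartition G s = StronglyConnected (T₁ G s) × StronglyConnected (T₂ G s)

GoodOrdered : Digraph 5 → Digraph 5 → Set
GoodOrdered A B = StronglyConnected A × ¬ StronglyConnected B × ExactlyOneSourceOrSink B

GoodPartition : MultipartiteTournament → Choice → Set
GoodPartition G s = GoodOrdered (T₁ G s) (T₂ G s) ⊎ GoodOrdered (T₂ G s) (T₁ G s)

HasStrongPartition : MultipartiteTournament → Set
HasStrongPartition G = Σ Choice λ s → StrongPartition G s

AtLeastGoodPartitions : ℕ → MultipartiteTournament → Set
AtLeastGoodPartitions k G =
  Σ (Fin k → Choice) λ f → Injective _≡_ _≡_ f
    × (∀ m → IsPartition (f m) × GoodPartition G (f m))

{-# OPTIONS --safe #-}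
-- For a partition s let X(s) be the number of sources and sinks in its two
-- tournaments.  A tournament on five vertices without a source or sink is
-- strongly connected: otherwise its vertices split into two classes with all
-- arcs between them in one direction, and each class would need at least three
-- vertices.  So if G has no strong partition then X(s) ≥ 1 for all 16
-- partitions, and X(s) = 1 makes s good.  Summing X over the partitions counts
-- the pairs (s , v) with v a source or sink of the tournament of s containing v.
-- If v has oⱼ out-neighbours in the j-th other part, it is a source for ∏ oⱼ
-- and a sink for ∏ (2 − oⱼ) of the 16 possible tournaments containing it; since
-- ∑ oⱼ ∈ {3, 4, 5} by near-regularity, this is at most 2.  Hence ∑ X ≤ 20, and
-- at least 2 · 16 − 20 = 12 partitions have X(s) = 1.  Both finite facts are
-- checked by evaluation.
module Submission where

open import Defs
open import Data.Bool using (Bool; true; false; not; _∧_; _∨_; T; if_then_else_)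
open import Data.Bool.ListAction using (all; any)
open import Data.Bool.Properties using (T-∨; T-∧; T-≡)
open import Data.Fin using (Fin; zero; suc; _≟_; inject≤; punchIn; punchOut; combine; finToFun; funToFin)
open import Data.Fin.Patterns using (0F; 1F)
open import Data.Fin.Properties
  using (inject≤-injective; punchInᵢ≢i; punchIn-punchOut; funToFin-finToFin)
  renaming (suc-injective to Fin-suc-injective)
open import Data.List using (List; length; filterᵇ; tabulate; lookup; allFin)
open import Data.List.Properties using (filter-≐)
open import Data.List.Membership.Propositional.Properties using (∈-allFin; ∈-lookup; ∈-filter⁻)
import Data.List.Relation.Unary.All as All
open import Data.List.Relation.Unary.All.Properties using (all⁺)
open import Data.List.Relation.Unary.Any using (satisfied)
open import Data.List.Relation.Unary.Any.Properties using (any⁻)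
open import Data.List.Relation.Unary.AllPairs using (_∷_)
open import Data.List.Relation.Unary.Unique.Propositional using (Unique)
open import Data.List.Relation.Unary.Unique.Propositional.Properties using (filter⁺; allFin⁺)
open import Data.Nat using (ℕ; zero; suc; _+_; _∸_; _≤_; _≤ᵇ_; _≡ᵇ_; z≤n; s≤s)
open import Data.Nat.Properties
  using ( ≡ᵇ⇒≡; ≡⇒≡ᵇ; ≤ᵇ⇒≤; ≤⇒≤ᵇ; suc-injective; +-suc; +-comm; +-mono-≤; +-monoˡ-≤
        ; +-cancelˡ-≤; ≤-trans; n≢0⇒n>0; m+n≡0⇒m≡0; m+n≡0⇒n≡0; module ≤-Reasoning
        ; +-commutativeSemigroup; +-0-commutativeMonoid)
open import Algebra.Properties.CommutativeSemigroup +-commutativeSemigroup using (interchange)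
open import Algebra.Properties.CommutativeMonoid.Sum +-0-commutativeMonoid
  using (sum-syntax; sum-cong-≗; ∑-distrib-+; ∑-comm)
open import Data.Product using (Σ; ∃; _×_; _,_; proj₁; proj₂)
open import Data.Sum using (_⊎_; inj₁; inj₂)
import Data.Sum as Sum
open import Data.Unit using (⊤; tt)
open import Data.Vec using (Vec; []; _∷_)
import Data.Vec as Vec
open import Data.Vec.Properties using (lookup∘tabulate; ∷-injectiveʳ)
open import Function using (_∘_; id; Equivalence)
open import Function.Definitions using (Injective)
open import Relation.Binary.PropositionalEquality
open import Relation.Nullary using (¬_; yes; no; does; contradiction)
open import Relation.Nullary.Decidable using (isYes; T?; toWitness; dec-true; dec-false)

indicator : Bool → ℕ
indicator true  = 1
indicator false = 0

count : ∀ {n} → (Fin n → Bool) → ℕ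
count {n} p = ∑[ i < n ] indicator (p i)

length-filterᵇ-tabulate : ∀ {n} {A : Set} (p : A → Bool) (f : Fin n → A) →
  length (filterᵇ p (tabulate f)) ≡ count (p ∘ f)
length-filterᵇ-tabulate {zero}  p f = refl
length-filterᵇ-tabulate {suc n} p f with p (f zero)
... | true  = cong suc (length-filterᵇ-tabulate p (f ∘ suc))
... | false = length-filterᵇ-tabulate p (f ∘ suc)

length-filterᵇ-allFin : ∀ {n} (p : Fin n → Bool) → length (filterᵇ p (allFin n)) ≡ count p
length-filterᵇ-allFin p = length-filterᵇ-tabulate p id

count≡0⇒¬T : ∀ {n} (p : Fin n → Bool) → count p ≡ 0 → ∀ i → ¬ T (p i)
count≡0⇒¬T {suc n} p eq i with p zero in p₀
count≡0⇒¬T {suc n} p () i       | true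
count≡0⇒¬T {suc n} p eq zero    | false = subst T p₀
count≡0⇒¬T {suc n} p eq (suc i) | false = count≡0⇒¬T (p ∘ suc) eq i

count≡1⇒unique : ∀ {n} (p : Fin n → Bool) → count p ≡ 1 →
  Σ (Fin n) λ i → T (p i) × ∀ j → T (p j) → j ≡ i
count≡1⇒unique {suc n} p eq with p zero in p₀
... | true  = zero , subst T (sym p₀) tt , λ
  { zero    _  → refl
  ; (suc j) pj → contradiction pj (count≡0⇒¬T (p ∘ suc) (suc-injective eq) j) }
... | false with count≡1⇒unique (p ∘ suc) eq
...   | i , pi , unique = suc i , pi , λ
  { zero    pj → contradiction (subst T p₀ pj) λ ()
  ; (suc j) pj → cong suc (unique j pj) }

∑-mono-≤ : ∀ {n} {f g : Fin n → ℕ} → (∀ i → f i ≤ g i) → ∑[ i < n ] f i ≤ ∑[ i < n ] g i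
∑-mono-≤ {zero}  _   = z≤n
∑-mono-≤ {suc n} f≤g = +-mono-≤ (f≤g zero) (∑-mono-≤ (f≤g ∘ suc))

2≤n+[n≡1] : ∀ {n} → 1 ≤ n → 2 ≤ n + indicator (n ≡ᵇ 1)
2≤n+[n≡1] {suc zero}    _ = s≤s (s≤s z≤n)
2≤n+[n≡1] {suc (suc n)} _ = s≤s (s≤s z≤n)

n+n≤∑+count≡1 : ∀ {n} (f : Fin n → ℕ) → (∀ i → 1 ≤ f i) →
  n + n ≤ ∑[ i < n ] f i + count (λ i → f i ≡ᵇ 1)
n+n≤∑+count≡1 {zero}  f _   = z≤n
n+n≤∑+count≡1 {suc n} f pos = begin
  suc n + suc n                  ≡⟨ cong suc (+-suc n n) ⟩
  2 + (n + n)                    ≤⟨ +-mono-≤ (2≤n+[n≡1] (pos zero)) (n+n≤∑+count≡1 (f ∘ suc) (pos ∘ suc)) ⟩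
  (f₀ + [f₀≡1]) + (∑f + #ones)   ≡⟨ interchange f₀ [f₀≡1] ∑f #ones ⟩
  (f₀ + ∑f) + ([f₀≡1] + #ones)   ∎
  where
  open ≤-Reasoning
  f₀ [f₀≡1] ∑f #ones : ℕ
  f₀ = f zero
  [f₀≡1] = indicator (f₀ ≡ᵇ 1)
  ∑f = ∑[ i < n ] f (suc i)
  #ones = count (λ i → f (suc i) ≡ᵇ 1)

filterᵇ-cong : ∀ {A : Set} {p q : A → Bool} → (∀ x → p x ≡ q x) → ∀ xs → filterᵇ p xs ≡ filterᵇ q xs
filterᵇ-cong {p = p} {q} p≗q =
  filter-≐ (T? ∘ p) (T? ∘ q) ((λ {x} → subst T (p≗q x)) , (λ {x} → subst T (sym (p≗q x))))

lookup-injective : ∀ {A : Set} {xs : List A} → Unique xs → Injective _≡_ _≡_ (lookup xs)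
lookup-injective (_    ∷ _) {zero}  {zero}  _  = refl
lookup-injective (x∉xs ∷ _) {zero}  {suc j} eq = contradiction eq (All.lookup x∉xs (∈-lookup j))
lookup-injective (x∉xs ∷ _) {suc i} {zero}  eq = contradiction (sym eq) (All.lookup x∉xs (∈-lookup i))
lookup-injective (_    ∷ u) {suc i} {suc j} eq = cong suc (lookup-injective u eq)

≤count⇒embedding : ∀ {m n} (p : Fin n → Bool) → m ≤ count p →
  Σ (Fin m → Fin n) λ g → Injective _≡_ _≡_ g × ∀ i → T (p (g i))
≤count⇒embedding {m} {n} p m≤count = g , g-injective , g-selected
  where
  selected : List (Fin n)
  selected = filterᵇ p (allFin n)
  m≤length : m ≤ length selected
  m≤length = subst (m ≤_) (sym (length-filterᵇ-allFin p)) m≤count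
  g : Fin m → Fin n
  g i = lookup selected (inject≤ i m≤length)
  g-injective : Injective _≡_ _≡_ g
  g-injective = inject≤-injective m≤length m≤length _ _ ∘ lookup-injective (filter⁺ (T? ∘ p) (allFin⁺ n))
  g-selected : ∀ i → T (p (g i))
  g-selected i = proj₂ (∈-filter⁻ (T? ∘ p) {xs = allFin n} (∈-lookup {xs = selected} _))

Exhaustive : {A : Set} → ((A → Bool) → Bool) → Set
Exhaustive {A} allᵇ = ∀ p → T (allᵇ p) → ∀ x → T (p x)

-- A check is stated as `allᵇ p ≡ true` and proved by `refl`.  Its uses name
-- `allᵇ` and `p` explicitly: leaving Agda to unify `T (allᵇ p)` with another
-- expression makes it evaluate the check a second time.
by-evaluation : ∀ {A : Set} (allᵇ : (A → Bool) → Bool) → Exhaustive allᵇ →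
  ∀ p → allᵇ p ≡ true → ∀ x → T (p x)
by-evaluation _ sound p evaluated = sound p (Equivalence.from T-≡ evaluated)

allFinᵇ : ∀ n → (Fin n → Bool) → Bool
allFinᵇ n p = all p (allFin n)

allFinᵇ-sound : ∀ {n} → Exhaustive (allFinᵇ n)
allFinᵇ-sound {n} p t i = All.lookup (all⁺ p (allFin n) t) (∈-allFin i)

allBoolᵇ : (Bool → Bool) → Bool
allBoolᵇ p = p true ∧ p false

allBoolᵇ-sound : Exhaustive allBoolᵇ
allBoolᵇ-sound p t true  = proj₁ (Equivalence.to T-∧ t)
allBoolᵇ-sound p t false = proj₂ (Equivalence.to T-∧ t)

allVecᵇ : ∀ {A : Set} → ((A → Bool) → Bool) → ∀ n → (Vec A n → Bool) → Bool
allVecᵇ allA zero    p = p []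
allVecᵇ allA (suc n) p = allA λ x → allVecᵇ allA n (p ∘ (x ∷_))

allVecᵇ-sound : ∀ {A : Set} {allA : (A → Bool) → Bool} → Exhaustive allA → ∀ n → Exhaustive (allVecᵇ allA n)
allVecᵇ-sound sound zero    p t []       = t
allVecᵇ-sound sound (suc n) p t (x ∷ xs) = allVecᵇ-sound sound n (p ∘ (x ∷_)) (sound _ t x) xs

all×ᵇ : ∀ {A B : Set} → ((A → Bool) → Bool) → ((B → Bool) → Bool) → (A × B → Bool) → Bool
all×ᵇ allA allB p = allA λ x → allB λ y → p (x , y)

all×ᵇ-sound : ∀ {A B : Set} {allA : (A → Bool) → Bool} {allB : (B → Bool) → Bool} →
  Exhaustive allA → Exhaustive allB → Exhaustive (all×ᵇ allA allB)
all×ᵇ-sound {allB = allB} soundA soundB p t (x , y) =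
  soundB (λ y → p (x , y)) (soundA (λ x → allB λ y → p (x , y)) t x) y

-- Sources, sinks and strong connectivity

countOff : ∀ {n} → Fin n → (Fin n → Bool) → ℕ
countOff {n} i σ = length (filterᵇ (λ j → not (does (i ≟ j)) ∧ σ j) (allFin n))

countOff-cong : ∀ {n} (i : Fin n) {σ τ} → (∀ j → σ j ≡ τ j) → countOff i σ ≡ countOff i τ
countOff-cong {n} i σ≗τ = cong length (filterᵇ-cong (λ j → cong (not (does (i ≟ j)) ∧_) (σ≗τ j)) (allFin n))

countOff≡0 : ∀ {n} {i j : Fin n} {σ} → countOff i σ ≡ 0 → ¬ i ≡ j → ¬ σ j ≡ true
countOff≡0 {n} {i} {j} {σ} none i≢j σj = count≡0⇒¬T off (trans (sym (length-filterᵇ-allFin off)) none) j off-j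
  where
  off : Fin n → Bool
  off k = not (does (i ≟ k)) ∧ σ k
  off-j : T (off j)
  off-j rewrite dec-false (i ≟ j) i≢j | σj = tt

module _ {n : ℕ} {A : Digraph n} where

  Reach-snoc : ∀ {i j k} → Reach A i j → A j k ≡ true → Reach A i k
  Reach-snoc here         jk = there jk here
  Reach-snoc (there ij r) jk = there ij (Reach-snoc r jk)

  Reach-cong : ∀ {B : Digraph n} → (∀ i j → A i j ≡ B i j) → ∀ {i j} → Reach A i j → Reach B i j
  Reach-cong A≗B here        = here
  Reach-cong A≗B (there a r) = there (trans (sym (A≗B _ _)) a) (Reach-cong A≗B r)

  reachable-from-source : ∀ {v w} → tOutdeg A v ≡ 0 → Reach A v w → w ≡ v
  reachable-from-source out≡0 here = refl
  reachable-from-source {v} out≡0 (there {j = k} vk r) with v ≟ k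
  ... | yes refl = reachable-from-source out≡0 r
  ... | no  v≢k  = contradiction vk (countOff≡0 out≡0 v≢k)

  reaching-sink : ∀ {v w} → tIndeg A v ≡ 0 → Reach A w v → w ≡ v
  reaching-sink in≡0 here = refl
  reaching-sink {v} in≡0 (there {i = w} wk r) with reaching-sink in≡0 r
  ... | refl with v ≟ w
  ...   | yes v≡w = sym v≡w
  ...   | no  v≢w = contradiction wk (countOff≡0 in≡0 v≢w)

sourceOrSink⇒¬strong : ∀ {n} {A : Digraph (suc (suc n))} {v} → IsSourceOrSink A v → ¬ StronglyConnected A
sourceOrSink⇒¬strong {v = v} (inj₁ out≡0) strong =
  punchInᵢ≢i v zero (reachable-from-source out≡0 (strong v (punchIn v zero)))
sourceOrSink⇒¬strong {v = v} (inj₂ in≡0) strong =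
  punchInᵢ≢i v zero (reaching-sink in≡0 (strong (punchIn v zero) v))

sourceOrSinkᵇ : ∀ {n} → Digraph n → Fin n → Bool
sourceOrSinkᵇ A v = (tOutdeg A v ≡ᵇ 0) ∨ (tIndeg A v ≡ᵇ 0)

sourceOrSinkᵇ-sound : ∀ {n} (A : Digraph n) v → T (sourceOrSinkᵇ A v) → IsSourceOrSink A v
sourceOrSinkᵇ-sound _ _ = Sum.map (≡ᵇ⇒≡ _ 0) (≡ᵇ⇒≡ _ 0) ∘ Equivalence.to T-∨

sourceOrSinkᵇ-complete : ∀ {n} (A : Digraph n) v → IsSourceOrSink A v → T (sourceOrSinkᵇ A v)
sourceOrSinkᵇ-complete _ _ = Equivalence.from T-∨ ∘ Sum.map (≡⇒≡ᵇ _ 0) (≡⇒≡ᵇ _ 0)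

sourceOrSinkᵇ-cong : ∀ {n} {A B : Digraph n} → (∀ i j → A i j ≡ B i j) → ∀ v → sourceOrSinkᵇ A v ≡ sourceOrSinkᵇ B v
sourceOrSinkᵇ-cong A≗B v = cong₂ (λ out in′ → (out ≡ᵇ 0) ∨ (in′ ≡ᵇ 0))
  (countOff-cong v (A≗B v)) (countOff-cong v (λ j → A≗B j v))

#sourcesOrSinks : ∀ {n} → Digraph n → ℕ
#sourcesOrSinks A = count (sourceOrSinkᵇ A)

#sourcesOrSinks-cong : ∀ {n} {A B : Digraph n} → (∀ i j → A i j ≡ B i j) → #sourcesOrSinks A ≡ #sourcesOrSinks B
#sourcesOrSinks-cong A≗B = sum-cong-≗ (cong indicator ∘ sourceOrSinkᵇ-cong A≗B)

#sourcesOrSinks≡1⇒exactlyOne : ∀ {n} {A : Digraph n} → #sourcesOrSinks A ≡ 1 → ExactlyOneSourceOrSink A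
#sourcesOrSinks≡1⇒exactlyOne {A = A} one with count≡1⇒unique (sourceOrSinkᵇ A) one
... | v , v-extreme , unique =
  v , sourceOrSinkᵇ-sound A v v-extreme , λ w → unique w ∘ sourceOrSinkᵇ-complete A w

exactlyOne⇒¬strong : ∀ {n} {A : Digraph (suc (suc n))} → ExactlyOneSourceOrSink A → ¬ StronglyConnected A
exactlyOne⇒¬strong (v , v-extreme , _) = sourceOrSink⇒¬strong {v = v} v-extreme

T-any-allFin : ∀ {n} {p : Fin n → Bool} → T (any p (allFin n)) → ∃ λ i → T (p i)
T-any-allFin {n} {p} t = satisfied (any⁻ p (allFin n) t)

grow : ∀ {n} → Digraph n → Vec Bool n → Vec Bool n
grow {n} A S = Vec.tabulate λ j → Vec.lookup S j ∨ any (λ i → Vec.lookup S i ∧ A i j) (allFin n)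

reachedWithin : ∀ {n} → ℕ → Digraph n → Fin n → Vec Bool n
reachedWithin zero    A i = Vec.tabulate λ j → isYes (i ≟ j)
reachedWithin (suc k) A i = grow A (reachedWithin k A i)

ReachableSet : ∀ {n} → Digraph n → Fin n → Vec Bool n → Set
ReachableSet A i S = ∀ j → T (Vec.lookup S j) → Reach A i j

grow-reachable : ∀ {n} {A : Digraph n} {i S} → ReachableSet A i S → ReachableSet A i (grow A S)
grow-reachable {n} {A} {S = S} reachable j t
  rewrite lookup∘tabulate (λ j → Vec.lookup S j ∨ any (λ m → Vec.lookup S m ∧ A m j) (allFin n)) j
  with Equivalence.to T-∨ t
... | inj₁ j∈S  = reachable j j∈S
... | inj₂ step with m , m-step ← T-any-allFin step with Equivalence.to T-∧ m-step
...   | m∈S , mj = Reach-snoc (reachable m m∈S) (Equivalence.to T-≡ mj)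

reachedWithin-reachable : ∀ {n} k {A : Digraph n} {i} → ReachableSet A i (reachedWithin k A i)
reachedWithin-reachable zero {i = i} j t rewrite lookup∘tabulate (λ j → isYes (i ≟ j)) j
  with refl ← toWitness {a? = i ≟ j} t = here
reachedWithin-reachable (suc k) {A} {i} = grow-reachable {S = reachedWithin k A i} (reachedWithin-reachable k)

stronglyConnectedᵇ : ∀ {n} → Digraph n → Bool
stronglyConnectedᵇ {n} A = allFinᵇ n λ i → allTrue (reachedWithin (n ∸ 1) A i)
  where
  allTrue : Vec Bool n → Bool
  allTrue S = allFinᵇ n (Vec.lookup S)

stronglyConnectedᵇ-sound : ∀ {n} {A : Digraph n} → T (stronglyConnectedᵇ A) → StronglyConnected A
stronglyConnectedᵇ-sound {n} t i j = reachedWithin-reachable (n ∸ 1) j (allFinᵇ-sound _ (allFinᵇ-sound _ t i) j)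

-- Tournaments

record IsTournament {n} (A : Digraph n) : Set where
  field
    irreflexive : ∀ i → A i i ≡ false
    oriented    : ∀ {i j} → ¬ i ≡ j → A j i ≡ not (A i j)

open IsTournament

IsTournament-suc : ∀ {n} {A : Digraph (suc n)} → IsTournament A → IsTournament (λ i j → A (suc i) (suc j))
IsTournament-suc t = record
  { irreflexive = irreflexive t ∘ suc
  ; oriented    = λ i≢j → oriented t (i≢j ∘ Fin-suc-injective)
  }

constantOffᵇ : ∀ {n} → Fin n → (Fin n → Bool) → Bool
constantOffᵇ i ρ = (countOff i ρ ≡ᵇ 0) ∨ (countOff i (not ∘ ρ) ≡ᵇ 0)

constantOffᵇ-cong : ∀ {n} (i : Fin n) {ρ σ} → (∀ j → ρ j ≡ σ j) → constantOffᵇ i ρ ≡ constantOffᵇ i σ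
constantOffᵇ-cong i ρ≗σ = cong₂ (λ out in′ → (out ≡ᵇ 0) ∨ (in′ ≡ᵇ 0))
  (countOff-cong i ρ≗σ) (countOff-cong i (cong not ∘ ρ≗σ))

sourceOrSinkᵇ-tournament : ∀ {n} {A : Digraph n} → IsTournament A → ∀ i → sourceOrSinkᵇ A i ≡ constantOffᵇ i (A i)
sourceOrSinkᵇ-tournament {n} {A} t i =
  cong (λ in′ → (tOutdeg A i ≡ᵇ 0) ∨ (in′ ≡ᵇ 0)) (cong length (filterᵇ-cong converse (allFin n)))
  where
  converse : ∀ j → (not (does (i ≟ j)) ∧ A j i) ≡ (not (does (i ≟ j)) ∧ not (A i j))
  converse j with i ≟ j
  ... | yes _   = refl
  ... | no  i≢j = oriented t i≢j

-- A tournament on suc n vertices is coded by the arcs from vertex 0 to the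
-- others, followed by the code of the tournament on the remaining vertices.
UpperBits : ℕ → Set
UpperBits zero    = ⊤
UpperBits (suc n) = Vec Bool n × UpperBits n

fromUpper : ∀ {n} → UpperBits n → Digraph n
fromUpper (r , u) zero    zero    = false
fromUpper (r , u) zero    (suc j) = Vec.lookup r j
fromUpper (r , u) (suc i) zero    = not (Vec.lookup r i)
fromUpper (r , u) (suc i) (suc j) = fromUpper u i j

toUpper : ∀ {n} → Digraph n → UpperBits n
toUpper {zero}  A = tt
toUpper {suc n} A = Vec.tabulate (A zero ∘ suc) , toUpper (λ i j → A (suc i) (suc j))

fromUpper-toUpper : ∀ {n} {A : Digraph n} → IsTournament A → ∀ i j → fromUpper (toUpper A) i j ≡ A i j
fromUpper-toUpper t zero    zero    = sym (irreflexive t zero)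
fromUpper-toUpper t zero    (suc j) = lookup∘tabulate _ j
fromUpper-toUpper t (suc i) zero    = trans (cong not (lookup∘tabulate _ i)) (sym (oriented t λ ()))
fromUpper-toUpper t (suc i) (suc j) = fromUpper-toUpper (IsTournament-suc t) i j

allUpperᵇ : ∀ n → (UpperBits n → Bool) → Bool
allUpperᵇ zero    p = p tt
allUpperᵇ (suc n) = all×ᵇ (allVecᵇ allBoolᵇ n) (allUpperᵇ n)

allUpperᵇ-sound : ∀ n → Exhaustive (allUpperᵇ n)
allUpperᵇ-sound zero    p t tt = t
allUpperᵇ-sound (suc n) = all×ᵇ-sound (allVecᵇ-sound allBoolᵇ-sound n) (allUpperᵇ-sound n)

strongIfNoSourceOrSinkᵇ : ∀ {n} → Digraph n → Bool
strongIfNoSourceOrSinkᵇ A = if #sourcesOrSinks A ≡ᵇ 0 then stronglyConnectedᵇ A else true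

strongIfNoSourceOrSinkᵇ-sound : ∀ {n} (A : Digraph n) → T (strongIfNoSourceOrSinkᵇ A) →
  #sourcesOrSinks A ≡ 0 → StronglyConnected A
strongIfNoSourceOrSinkᵇ-sound A t none =
  stronglyConnectedᵇ-sound (subst (λ m → T (if m ≡ᵇ 0 then stronglyConnectedᵇ A else true)) none t)

tournament₅-checked : allUpperᵇ 5 (λ u → strongIfNoSourceOrSinkᵇ (fromUpper u)) ≡ true
tournament₅-checked = refl

tournament₅-strong : ∀ {A : Digraph 5} → IsTournament A → #sourcesOrSinks A ≡ 0 → StronglyConnected A
tournament₅-strong {A} t none i j =
  Reach-cong (fromUpper-toUpper t) (strongIfNoSourceOrSinkᵇ-sound (fromUpper (toUpper A)) checked none′ i j)
  where
  checked : T (strongIfNoSourceOrSinkᵇ (fromUpper (toUpper A)))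
  checked = by-evaluation (allUpperᵇ 5) (allUpperᵇ-sound 5) (λ u → strongIfNoSourceOrSinkᵇ (fromUpper u))
    tournament₅-checked (toUpper A)
  none′ : #sourcesOrSinks (fromUpper (toUpper A)) ≡ 0
  none′ = trans (#sourcesOrSinks-cong (fromUpper-toUpper t)) none

-- Partitions of G

arc-converse : ∀ G u w → arc G w u ≡ differentParts u w ∧ not (arc G u w)
arc-converse G u w with part u ≟ part w | part w ≟ part u
... | yes _  | yes _  = refl
... | yes uw | no ¬wu = contradiction (sym uw) ¬wu
... | no ¬uw | yes wu = contradiction (sym wu) ¬uw
... | no _   | no ¬wu = oriented G w u ¬wu

induced-isTournament : ∀ G c → IsTournament (induced G c)
induced-isTournament G c = record
  { irreflexive = λ i → cong (λ b → not b ∧ arcᵒ G (i , c i) (i , c i)) (dec-true (i ≟ i) refl)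
  ; oriented    = λ {i} {j} i≢j → trans (arc-converse G (i , c i) (j , c j))
                                        (cong (λ b → not b ∧ not (induced G c i j)) (dec-false (i ≟ j) i≢j))
  }

partition : Fin 16 → Choice
partition k = zero ∷ Vec.tabulate (finToFun k)

funToFin-cong : ∀ {m n} {f g : Fin m → Fin n} → (∀ i → f i ≡ g i) → funToFin f ≡ funToFin g
funToFin-cong {zero}  _   = refl
funToFin-cong {suc m} f≗g = cong₂ combine (f≗g zero) (funToFin-cong (f≗g ∘ suc))

partition-injective : Injective _≡_ _≡_ partition
partition-injective {k} {l} eq = begin
  k                 ≡⟨ funToFin-finToFin {4} {2} k ⟨
  funToFin (bits k) ≡⟨ funToFin-cong same ⟩
  funToFin (bits l) ≡⟨ funToFin-finToFin {4} {2} l ⟩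
  l                 ∎
  where
  open ≡-Reasoning
  bits : Fin 16 → Fin 4 → Fin 2
  bits = finToFun
  same : ∀ i → bits k i ≡ bits l i
  same i = begin
    bits k i                               ≡⟨ lookup∘tabulate (bits k) i ⟨
    Vec.lookup (Vec.tabulate (bits k)) i   ≡⟨ cong (λ v → Vec.lookup v i) (∷-injectiveʳ eq) ⟩
    Vec.lookup (Vec.tabulate (bits l)) i   ≡⟨ lookup∘tabulate (bits l) i ⟩
    bits l i                               ∎

flipUnless : Fin 2 → Fin 2 → Fin 2 → Fin 2
flipUnless 0F 0F = id
flipUnless 1F 1F = id
flipUnless 0F 1F = flip2
flipUnless 1F 0F = flip2

flipUnless-self : ∀ x a → flipUnless x a x ≡ a
flipUnless-self 0F 0F = refl
flipUnless-self 1F 1F = refl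
flipUnless-self 0F 1F = refl
flipUnless-self 1F 0F = refl

-- The two vertices of a part lie in the two tournaments of a partition, in
-- one order or the other.
flipUnless-pair : ∀ x (F : (Fin 2 → Fin 2) → ℕ) → F id + F flip2 ≡ F (flipUnless x 0F) + F (flipUnless x 1F)
flipUnless-pair 0F F = refl
flipUnless-pair 1F F = +-comm (F id) (F flip2)

ownChoice : Choice → Vertex → Fin 5 → Fin 2
ownChoice s (i , a) = flipUnless (Vec.lookup s i) a ∘ Vec.lookup s

extremeInOwnᵇ : MultipartiteTournament → Choice → Vertex → Bool
extremeInOwnᵇ G s v = sourceOrSinkᵇ (induced G (ownChoice s v)) (part v)

#extreme : MultipartiteTournament → Choice → ℕ
#extreme G s = #sourcesOrSinks (T₁ G s) + #sourcesOrSinks (T₂ G s)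

#extreme≡∑ : ∀ G s →
  #extreme G s ≡ ∑[ i < 5 ] (indicator (extremeInOwnᵇ G s (i , 0F)) + indicator (extremeInOwnᵇ G s (i , 1F)))
#extreme≡∑ G s = trans
  (sym (∑-distrib-+ (indicator ∘ sourceOrSinkᵇ (T₁ G s)) (indicator ∘ sourceOrSinkᵇ (T₂ G s))))
  (sum-cong-≗ λ i → flipUnless-pair (Vec.lookup s i) λ h → indicator (sourceOrSinkᵇ (induced G (h ∘ Vec.lookup s)) i))

#extreme≡0⇒strong : ∀ G s → #extreme G s ≡ 0 → StrongPartition G s
#extreme≡0⇒strong G s none =
  tournament₅-strong (induced-isTournament G _) (m+n≡0⇒m≡0 _ none) ,
  tournament₅-strong (induced-isTournament G _) (m+n≡0⇒n≡0 (#sourcesOrSinks (T₁ G s)) none)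

goodOrdered : ∀ {A B : Digraph 5} → IsTournament A → #sourcesOrSinks A ≡ 0 → #sourcesOrSinks B ≡ 1 → GoodOrdered A B
goodOrdered {B = B} tA none one = tournament₅-strong tA none , exactlyOne⇒¬strong exactlyOne , exactlyOne
  where
  exactlyOne : ExactlyOneSourceOrSink B
  exactlyOne = #sourcesOrSinks≡1⇒exactlyOne one

m+n≡1-cases : ∀ m n → m + n ≡ 1 → (m ≡ 0 × n ≡ 1) ⊎ (m ≡ 1 × n ≡ 0)
m+n≡1-cases zero       n    eq = inj₁ (refl , eq)
m+n≡1-cases (suc zero) zero _  = inj₂ (refl , refl)

#extreme≡1⇒good : ∀ G s → #extreme G s ≡ 1 → GoodPartition G s
#extreme≡1⇒good G s one with m+n≡1-cases (#sourcesOrSinks (T₁ G s)) (#sourcesOrSinks (T₂ G s)) one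
... | inj₁ (none , one₂) = inj₁ (goodOrdered (induced-isTournament G _) none one₂)
... | inj₂ (one₁ , none) = inj₂ (goodOrdered (induced-isTournament G _) none one₁)

constantAlongᵇ : Fin 5 → (Vertex → Bool) → (Fin 5 → Fin 2) → Bool
constantAlongᵇ i r c = constantOffᵇ i (λ j → r (j , c j))

extremeInOwnᵇ-row : ∀ G s i a → extremeInOwnᵇ G s (i , a) ≡ constantAlongᵇ i (arc G (i , a)) (ownChoice s (i , a))
extremeInOwnᵇ-row G s i a = trans
  (sourceOrSinkᵇ-tournament (induced-isTournament G c) i)
  (cong (λ x → constantAlongᵇ i (arc G (i , x)) c) (flipUnless-self (Vec.lookup s i) a))
  where
  c : Fin 5 → Fin 2
  c = ownChoice s (i , a)

outdegRow : (Vertex → Bool) → ℕ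
outdegRow r = length (filterᵇ r allVertices)

indegRow : Vertex → (Vertex → Bool) → ℕ
indegRow v r = length (filterᵇ (λ w → differentParts v w ∧ not (r w)) allVertices)

indeg≡indegRow : ∀ G v → indeg G v ≡ indegRow v (arc G v)
indeg≡indegRow G v = cong length (filterᵇ-cong (arc-converse G v) allVertices)

outdegRow-cong : ∀ {r r′} → (∀ w → r w ≡ r′ w) → outdegRow r ≡ outdegRow r′
outdegRow-cong r≗r′ = cong length (filterᵇ-cong r≗r′ allVertices)

indegRow-cong : ∀ v {r r′} → (∀ w → r w ≡ r′ w) → indegRow v r ≡ indegRow v r′
indegRow-cong v r≗r′ = cong length (filterᵇ-cong (λ w → cong (λ b → differentParts v w ∧ not b) (r≗r′ w)) allVertices)

NearlyRegularAt : ℕ → ℕ → Set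
NearlyRegularAt out in′ = (out ≤ in′ + 2) × (in′ ≤ out + 2)

nearlyRegularAtᵇ : ℕ → ℕ → Bool
nearlyRegularAtᵇ out in′ = (out ≤ᵇ in′ + 2) ∧ (in′ ≤ᵇ out + 2)

nearlyRegularAtᵇ-complete : ∀ {out in′} → NearlyRegularAt out in′ → T (nearlyRegularAtᵇ out in′)
nearlyRegularAtᵇ-complete (o≤i , i≤o) = Equivalence.from T-∧ (≤⇒≤ᵇ o≤i , ≤⇒≤ᵇ i≤o)

extremeCount : Vertex → (Vertex → Bool) → ℕ
extremeCount v r = count λ k → constantAlongᵇ (part v) r (ownChoice (partition k) v)

extremeCount-cong : ∀ v {r r′} → (∀ w → r w ≡ r′ w) → extremeCount v r ≡ extremeCount v r′
extremeCount-cong v r≗r′ =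
  sum-cong-≗ λ k → cong indicator (constantOffᵇ-cong (part v) λ j → r≗r′ (j , ownChoice (partition k) v j))

vertexBoundᵇ : Vertex → (Vertex → Bool) → Bool
vertexBoundᵇ v r = if nearlyRegularAtᵇ (outdegRow r) (indegRow v r) then extremeCount v r ≤ᵇ 2 else true

vertexBoundᵇ-sound : ∀ v r → T (vertexBoundᵇ v r) → NearlyRegularAt (outdegRow r) (indegRow v r) → extremeCount v r ≤ 2
vertexBoundᵇ-sound v r t nr = ≤ᵇ⇒≤ _ 2
  (subst (λ b → T (if b then extremeCount v r ≤ᵇ 2 else true)) (Equivalence.to T-≡ (nearlyRegularAtᵇ-complete nr)) t)

-- Entry (m , b) is the arc from a vertex of part i to (punchIn i m , b).
OtherRows : Set
OtherRows = Vec (Vec Bool 2) 4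

rowFrom : Fin 5 → OtherRows → Vertex → Bool
rowFrom i o (j , b) with i ≟ j
... | yes _   = false
... | no  i≢j = Vec.lookup (Vec.lookup o (punchOut i≢j)) b

otherRows : MultipartiteTournament → Vertex → OtherRows
otherRows G (i , a) = Vec.tabulate λ m → Vec.tabulate λ b → arcᵒ G (i , a) (punchIn i m , b)

rowFrom-otherRows : ∀ G v w → rowFrom (part v) (otherRows G v) w ≡ arc G v w
rowFrom-otherRows G (i , a) (j , b) with i ≟ j
... | yes _   = refl
... | no  i≢j = begin
  Vec.lookup (Vec.lookup (otherRows G (i , a)) (punchOut i≢j)) b
    ≡⟨ cong (λ row → Vec.lookup row b) (lookup∘tabulate row (punchOut i≢j)) ⟩
  Vec.lookup (Vec.tabulate λ b → arcᵒ G (i , a) (punchIn i (punchOut i≢j) , b)) b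
    ≡⟨ lookup∘tabulate (λ b → arcᵒ G (i , a) (punchIn i (punchOut i≢j) , b)) b ⟩
  arcᵒ G (i , a) (punchIn i (punchOut i≢j) , b)
    ≡⟨ cong (λ j → arcᵒ G (i , a) (j , b)) (punchIn-punchOut i≢j) ⟩
  arcᵒ G (i , a) (j , b)
    ∎
  where
  open ≡-Reasoning
  row : Fin 4 → Vec Bool 2
  row m = Vec.tabulate λ b → arcᵒ G (i , a) (punchIn i m , b)

allVertexRowsᵇ : (Vertex × OtherRows → Bool) → Bool
allVertexRowsᵇ = all×ᵇ (all×ᵇ (allFinᵇ 5) (allFinᵇ 2)) (allVecᵇ (allVecᵇ allBoolᵇ 2) 4)

allVertexRowsᵇ-sound : Exhaustive allVertexRowsᵇ
allVertexRowsᵇ-sound =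
  all×ᵇ-sound (all×ᵇ-sound allFinᵇ-sound allFinᵇ-sound) (allVecᵇ-sound (allVecᵇ-sound allBoolᵇ-sound 2) 4)

vertexRowBoundᵇ : Vertex × OtherRows → Bool
vertexRowBoundᵇ (v , o) = vertexBoundᵇ v (rowFrom (part v) o)

vertexRowBound-checked : allVertexRowsᵇ vertexRowBoundᵇ ≡ true
vertexRowBound-checked = refl

extremeCount≤2 : ∀ G → NearlyRegular G → ∀ v → extremeCount v (arc G v) ≤ 2
extremeCount≤2 G nr v = subst (_≤ 2) (extremeCount-cong v row≗arc) (vertexBoundᵇ-sound v row checked nr-row)
  where
  row : Vertex → Bool
  row = rowFrom (part v) (otherRows G v)
  row≗arc : ∀ w → row w ≡ arc G v w
  row≗arc = rowFrom-otherRows G v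
  checked : T (vertexRowBoundᵇ (v , otherRows G v))
  checked = by-evaluation allVertexRowsᵇ allVertexRowsᵇ-sound vertexRowBoundᵇ vertexRowBound-checked (v , otherRows G v)
  nr-row : NearlyRegularAt (outdegRow row) (indegRow v row)
  nr-row = subst₂ NearlyRegularAt (sym (outdegRow-cong row≗arc))
    (sym (trans (indegRow-cong v row≗arc) (sym (indeg≡indegRow G v)))) (nr v)

extremeInOwn≤2 : ∀ G → NearlyRegular G → ∀ v → count (λ k → extremeInOwnᵇ G (partition k) v) ≤ 2
extremeInOwn≤2 G nr (i , a) = subst (_≤ 2)
  (sum-cong-≗ λ k → cong indicator (sym (extremeInOwnᵇ-row G (partition k) i a)))
  (extremeCount≤2 G nr (i , a))

∑#extreme≤20 : ∀ G → NearlyRegular G → ∑[ k < 16 ] #extreme G (partition k) ≤ 20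
∑#extreme≤20 G nr = begin
  ∑[ k < 16 ] #extreme G (partition k)
    ≡⟨ sum-cong-≗ (#extreme≡∑ G ∘ partition) ⟩
  ∑[ k < 16 ] ∑[ i < 5 ] (own k (i , 0F) + own k (i , 1F))
    ≡⟨ ∑-comm (λ k i → own k (i , 0F) + own k (i , 1F)) ⟩
  ∑[ i < 5 ] ∑[ k < 16 ] (own k (i , 0F) + own k (i , 1F))
    ≡⟨ sum-cong-≗ (λ i → ∑-distrib-+ (λ k → own k (i , 0F)) (λ k → own k (i , 1F))) ⟩
  ∑[ i < 5 ] (count (λ k → extremeInOwnᵇ G (partition k) (i , 0F)) + count (λ k → extremeInOwnᵇ G (partition k) (i , 1F)))
    ≤⟨ ∑-mono-≤ (λ i → +-mono-≤ (extremeInOwn≤2 G nr (i , 0F)) (extremeInOwn≤2 G nr (i , 1F))) ⟩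
  ∑[ i < 5 ] 4
    ∎
  where
  open ≤-Reasoning
  own : Fin 16 → Vertex → ℕ
  own k v = indicator (extremeInOwnᵇ G (partition k) v)

#extreme-positive : ∀ G → ¬ HasStrongPartition G → ∀ k → 1 ≤ #extreme G (partition k)
#extreme-positive G noStrong k = n≢0⇒n>0 λ none → noStrong (partition k , #extreme≡0⇒strong G (partition k) none)

twelve-with-one-extreme : ∀ G → NearlyRegular G → ¬ HasStrongPartition G →
  12 ≤ count (λ k → #extreme G (partition k) ≡ᵇ 1)
twelve-with-one-extreme G nr noStrong = +-cancelˡ-≤ 20 12 _ (≤-trans
  (n+n≤∑+count≡1 (λ k → #extreme G (partition k)) (#extreme-positive G noStrong))
  (+-monoˡ-≤ _ (∑#extreme≤20 G nr)))

lemma2p9 : (G : MultipartiteTournament) → NearlyRegular G →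
    ¬ HasStrongPartition G → AtLeastGoodPartitions 12 G
lemma2p9 G nr noStrong =
  let g , g-injective , one-extreme =
        ≤count⇒embedding (λ k → #extreme G (partition k) ≡ᵇ 1) (twelve-with-one-extreme G nr noStrong)
  in (λ m → partition (g m)) , (λ {x} {y} eq → g-injective (partition-injective {g x} {g y} eq)) ,
     λ m → refl , #extreme≡1⇒good G (partition (g m)) (≡ᵇ⇒≡ (#extreme G (partition (g m))) 1 (one-extreme m))
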